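{- Let $k$ and $n$ be positive integers and let $P$ be a $(kn,n)$-Dyck path. Let $\sigma=(\sigma_1,\dots,\sigma_{kn+n})$ be the output sequence of the sweep map applied from right to left to $P$, and $\tau=(\tau_1,\dots,\tau_{kn+n})$ the corresponding sequence of levels. If $\sigma_i=\mathrm{W}$ has level $\tau_i=mn$ and $\sigma_{i+1}=\mathrm{S}$, then $\tau_{i+1}=mn$ as well. Moreover, if in addition $\sigma_{i+2}=\mathrm{S}$, then $\tau_{i+2}=mn$ also.
   Context: A $(kn,n)$-Dyck path is a lattice path from $(0,0)$ to $(kn,n)$ consisting of $kn$ unit east steps and $n$ unit north steps that never passes below the line $y=x/k$. The level of a lattice point $(x,y)$ is $kn\cdot y-n\cdot x$; thus the path stays at levels $\ge 0$, a north step raises the level by $kn$ and an east step lowers it by $n$. Each step is recorded by its starting point: a north step is recorded as S (its south endpoint) and an east step as W (its west endpoint); the level of a step is the level of its starting point. The sweep map applied from right to left lists all $kn+n$ steps in order of nondecreasing level, where among steps of equal level the one occurring later along the path (further to the right) is listed first. The output sequence $\sigma$ is the resulting word in the letters S and W, and $\tau_j$ is the level of the step listed in position $j$ (so $\tau$ is nondecreasing). -}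

module Defs where

open import Data.Nat using (ℕ; zero; suc)
open import Data.Integer using (ℤ; +_; _+_; _-_; _*_; _≤_; _<_; _<?_; _≟_)
open import Data.List using (List; []; _∷_; length; filter)
open import Data.Maybe using (Maybe; just; nothing)
open import Data.Product using (_×_; _,_; proj₁)
open import Relation.Nullary using (yes; no)
open import Relation.Binary.PropositionalEquality using (_≡_)
open import Data.List.Relation.Unary.All using (All)

-- A step of a lattice path, named by the letter that records it:
-- S = a north step (recorded by its south endpoint),
-- W = an east step (recorded by its west endpoint).
data Step : Set where
  S W : Step

countS : List Step → ℕ
countS [] = 0
countS (S ∷ p) = suc (countS p)
countS (W ∷ p) = countS p

countW : List Step → ℕ
countW [] = 0
countW (S ∷ p) = countW p
countW (W ∷ p) = suc (countW p)

δ : ℕ → ℕ → Step → ℤ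
δ k n S = + (k Data.Nat.* n)
δ k n W = Data.Integer.- (+ n)

startLevels : ℕ → ℕ → ℤ → List Step → List ℤ
startLevels k n ℓ [] = []
startLevels k n ℓ (s ∷ p) = ℓ ∷ startLevels k n (ℓ + δ k n s) p

pointLevels : ℕ → ℕ → ℤ → List Step → List ℤ
pointLevels k n ℓ [] = ℓ ∷ []
pointLevels k n ℓ (s ∷ p) = ℓ ∷ pointLevels k n (ℓ + δ k n s) p

-- P is a (kn,n)-Dyck path: kn east steps, n north steps,
-- and every lattice point on it has level ≥ 0 (never below y = x/k).
record IsDyck (k n : ℕ) (P : List Step) : Set where
  field
    eastCount  : countW P ≡ k Data.Nat.* n
    northCount : countS P ≡ n
    aboveDiag  : All (λ ℓ → + 0 ≤ ℓ) (pointLevels k n (+ 0) P)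

record Entry : Set where
  constructor entry
  field
    letter : Step
    level  : ℤ
    pos    : ℕ

annotate : ℕ → ℕ → ℕ → ℤ → List Step → List Entry
annotate k n i ℓ [] = []
annotate k n i ℓ (s ∷ p) = entry s ℓ i ∷ annotate k n (suc i) (ℓ + δ k n s) p

before : Entry → Entry → Set
before (entry _ l i) (entry _ l' i') with l <? l' | l ≟ l'
... | yes _ | _     = Data.Unit.⊤ where import Data.Unit
... | no _  | yes _ = i' Data.Nat.< i
... | no _  | no _  = Data.Empty.⊥ where import Data.Empty

before? : (a b : Entry) → Relation.Nullary.Dec (before a b)
before? (entry _ l i) (entry _ l' i') with l <? l' | l ≟ l'
... | yes _ | _     = yes Data.Unit.tt where import Data.Unit
... | no _  | yes _ = i' Data.Nat.<? i
... | no _  | no _  = no (λ ()) where import Data.Empty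

insert : Entry → List Entry → List Entry
insert a [] = a ∷ []
insert a (b ∷ bs) with before? a b
... | yes _ = a ∷ b ∷ bs
... | no _  = b ∷ insert a bs

sortSweep : List Entry → List Entry
sortSweep [] = []
sortSweep (a ∷ as) = insert a (sortSweep as)

-- The sweep map applied from right to left: all steps of P listed in order of
-- nondecreasing level, ties broken by listing the later step first.
-- The j-th entry (0-based) gives σ_{j+1} (its letter) and τ_{j+1} (its level).
sweep : ℕ → ℕ → List Step → List (Step × ℤ)
sweep k n P = Data.List.map (λ e → Entry.letter e , Entry.level e)
                (sortSweep (annotate k n 0 (+ 0) P))

_‼_ : {A : Set} → List A → ℕ → Maybe A
[] ‼ _ = nothing
(x ∷ xs) ‼ zero = just x
(x ∷ xs) ‼ suc i = xs ‼ i

-- Every S listed by the sweep has the same level as the entry listed just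
-- before it, whatever that entry is.
-- Suppose an S step e of level t > 0
-- came right after an entry a of smaller level.  After e the path is at level
-- t + kn and descends to its final level 0 < t in steps of n, so some later
-- step f starts at level exactly t.  Being later, f is listed before e, hence
-- (since a comes right before e) not after a; but its level t exceeds that of a.
module Submission where

open import Defs
open import Data.Nat using (ℕ; suc; NonZero)
open import Data.List using (List)
open import Data.Integer using (ℤ; +_; _*_)
open import Data.Product using (_×_; _,_)
open import Data.Maybe using (just)
open import Relation.Binary.PropositionalEquality using (_≡_)

import Data.Nat as ℕ
import Data.Nat.Properties as ℕ
open import Data.Integer using (_+_; _-_; _<_; _≤_; _<?_; _≟_)
import Data.Integer.Properties as ℤ
open import Data.Integer.Tactic.RingSolver using (solve-∀)
open import Data.List using ([]; _∷_; map)
open import Data.List.Relation.Unary.All as All using (All; []; _∷_)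
open import Data.List.Relation.Unary.Any using (here; there)
open import Data.List.Relation.Unary.AllPairs using (AllPairs; []; _∷_)
open import Data.List.Membership.Propositional using (_∈_)
open import Data.List.Relation.Binary.Permutation.Propositional
  using (_↭_; prep; swap; ↭-refl; ↭-sym; ↭-trans)
open import Data.List.Relation.Binary.Permutation.Propositional.Properties
  using (∈-resp-↭; All-resp-↭)
open import Data.Product using (∃)
open import Data.Sum using (_⊎_; inj₁; inj₂)
open import Data.Empty using (⊥; ⊥-elim)
open import Relation.Nullary using (¬_; yes; no)
open import Relation.Binary.PropositionalEquality
  using (refl; sym; trans; cong; subst; module ≡-Reasoning)
open Entry

<-level⇒before : ∀ a b → level a < level b → before a b
<-level⇒before (entry _ l i) (entry _ l′ i′) l<l′ with l <? l′ | l ≟ l′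
... | yes _ | _ = _
... | no l≮l′ | _ = ⊥-elim (l≮l′ l<l′)

≡-level⇒before : ∀ a b → level a ≡ level b → pos b ℕ.< pos a → before a b
≡-level⇒before (entry _ l i) (entry _ l′ i′) l≡l′ i′<i with l <? l′ | l ≟ l′
... | yes _ | _ = _
... | no _ | yes _ = i′<i
... | no _ | no l≢l′ = ⊥-elim (l≢l′ l≡l′)

before-inv : ∀ a b → before a b →
  level a < level b ⊎ (level a ≡ level b × pos b ℕ.< pos a)
before-inv (entry _ l i) (entry _ l′ i′) a<b with l <? l′ | l ≟ l′
... | yes l<l′ | _ = inj₁ l<l′
... | no _ | yes l≡l′ = inj₂ (l≡l′ , a<b)

before-asym : ∀ a b → before a b → ¬ before b a
before-asym a b a<b b<a with before-inv a b a<b | before-inv b a b<a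
... | inj₁ x | inj₁ y = ℤ.<-asym x y
... | inj₁ x | inj₂ (e , _) = ℤ.<-irrefl (sym e) x
... | inj₂ (e , _) | inj₁ y = ℤ.<-irrefl (sym e) y
... | inj₂ (_ , x) | inj₂ (_ , y) = ℕ.<-asym x y

before-irrefl : ∀ a → ¬ before a a
before-irrefl a a<a = before-asym a a a<a a<a

before-trans : ∀ a b c → before a b → before b c → before a c
before-trans a b c a<b b<c with before-inv a b a<b | before-inv b c b<c
... | inj₁ x | inj₁ y = <-level⇒before a c (ℤ.<-trans x y)
... | inj₁ x | inj₂ (e , _) = <-level⇒before a c (subst (level a <_) e x)
... | inj₂ (e , _) | inj₁ y = <-level⇒before a c (subst (_< level c) (sym e) y)
... | inj₂ (e , x) | inj₂ (e′ , y) = ≡-level⇒before a c (trans e e′) (ℕ.<-trans y x)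

Sorted : List Entry → Set
Sorted = AllPairs (λ a b → ¬ before b a)

insert-↭ : ∀ a ys → insert a ys ↭ a ∷ ys
insert-↭ a [] = ↭-refl
insert-↭ a (b ∷ bs) with before? a b
... | yes _ = ↭-refl
... | no _ = ↭-trans (prep b (insert-↭ a bs)) (swap b a ↭-refl)

sortSweep-↭ : ∀ xs → sortSweep xs ↭ xs
sortSweep-↭ [] = ↭-refl
sortSweep-↭ (a ∷ as) = ↭-trans (insert-↭ a (sortSweep as)) (prep a (sortSweep-↭ as))

insert-sorted : ∀ a ys → Sorted ys → Sorted (insert a ys)
insert-sorted a [] [] = [] ∷ []
insert-sorted a (b ∷ bs) (b≼bs ∷ bs-sorted) with before? a b
... | yes a<b = (before-asym a b a<b ∷ All.map (λ {x} → a≼ {x}) b≼bs) ∷ b≼bs ∷ bs-sorted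
  where
  a≼ : ∀ {x} → ¬ before x b → ¬ before x a
  a≼ {x} x≮b x<a = x≮b (before-trans x a b x<a a<b)
... | no a≮b = All-resp-↭ (↭-sym (insert-↭ a bs)) (a≮b ∷ b≼bs) ∷ insert-sorted a bs bs-sorted

sortSweep-sorted : ∀ xs → Sorted (sortSweep xs)
sortSweep-sorted [] = []
sortSweep-sorted (a ∷ as) = insert-sorted a (sortSweep as) (sortSweep-sorted as)

‼-∈ : ∀ {A : Set} (xs : List A) j {a} → xs ‼ j ≡ just a → a ∈ xs
‼-∈ (x ∷ xs) ℕ.zero refl = here refl
‼-∈ (x ∷ xs) (suc j) xs[j]≡a = there (‼-∈ xs j xs[j]≡a)

‼-map : ∀ {A B : Set} (f : A → B) (xs : List A) j {b} → map f xs ‼ j ≡ just b →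
  ∃ λ a → xs ‼ j ≡ just a × f a ≡ b
‼-map f (x ∷ xs) ℕ.zero refl = x , refl , refl
‼-map f (x ∷ xs) (suc j) eq = ‼-map f xs j eq

sorted-‼-suc : ∀ xs j {a e} → Sorted xs →
  xs ‼ j ≡ just a → xs ‼ suc j ≡ just e → ¬ before e a
sorted-‼-suc (x ∷ xs) ℕ.zero (x≼xs ∷ _) refl xs[0]≡e = All.lookup x≼xs (‼-∈ xs 0 xs[0]≡e)
sorted-‼-suc (x ∷ xs) (suc j) (_ ∷ xs-sorted) = sorted-‼-suc xs j xs-sorted

sorted-before-successor : ∀ xs j {a e f} → Sorted xs →
  xs ‼ j ≡ just a → xs ‼ suc j ≡ just e → f ∈ xs → before f e → ¬ before a f
sorted-before-successor (x ∷ y ∷ ys) ℕ.zero (_ ∷ y≼ys ∷ _) refl refl f∈ f<e with f∈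
... | here refl = before-irrefl x
... | there (here refl) = ⊥-elim (before-irrefl y f<e)
... | there (there f∈ys) = ⊥-elim (All.lookup y≼ys f∈ys f<e)
sorted-before-successor (x ∷ xs) (suc j) (x≼xs ∷ _) xs[j]≡a _ (here refl) _ =
  All.lookup x≼xs (‼-∈ xs j xs[j]≡a)
sorted-before-successor (x ∷ xs) (suc j) (_ ∷ xs-sorted) xs[j]≡a xs[j+1]≡e (there f∈) f<e =
  sorted-before-successor xs j xs-sorted xs[j]≡a xs[j+1]≡e f∈ f<e

module Path (k n : ℕ) where

  finalLevel : ℤ → List Step → ℤ
  finalLevel ℓ [] = ℓ
  finalLevel ℓ (s ∷ p) = finalLevel (ℓ + δ k n s) p

  finalLevel-balance : ∀ ℓ P →
    finalLevel ℓ P + + (countW P ℕ.* n) ≡ ℓ + + (countS P ℕ.* (k ℕ.* n))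
  finalLevel-balance ℓ [] = refl
  finalLevel-balance ℓ (S ∷ P) =
    trans (finalLevel-balance (ℓ + + (k ℕ.* n)) P) (ℤ.+-assoc ℓ _ _)
  finalLevel-balance ℓ (W ∷ P) = begin
    F + (+ n + w)   ≡⟨ shuffle F (+ n) w ⟩
    (F + w) + + n   ≡⟨ cong (_+ + n) (finalLevel-balance (ℓ - + n) P) ⟩
    (ℓ - + n + s) + + n ≡⟨ cancel ℓ (+ n) s ⟩
    ℓ + s ∎
    where
    open ≡-Reasoning
    F w s : ℤ
    F = finalLevel (ℓ - + n) P
    w = + (countW P ℕ.* n)
    s = + (countS P ℕ.* (k ℕ.* n))
    shuffle : ∀ x y z → x + (y + z) ≡ (x + z) + y
    shuffle = solve-∀
    cancel : ∀ x y z → (x - y + z) + y ≡ x + z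
    cancel = solve-∀

  finalLevel-dyck : ∀ P → IsDyck k n P → finalLevel (+ 0) P ≡ + 0
  finalLevel-dyck P dyck = begin
    F                 ≡⟨ add-sub F c ⟩
    (F + c) - c       ≡⟨ cong (_- c) balance ⟩
    c - c             ≡⟨ ℤ.+-inverseʳ c ⟩
    + 0 ∎
    where
    open ≡-Reasoning
    open IsDyck dyck
    F c : ℤ
    F = finalLevel (+ 0) P
    c = + (k ℕ.* n ℕ.* n)
    add-sub : ∀ x y → x ≡ (x + y) - y
    add-sub = solve-∀
    balance : F + c ≡ c
    balance with finalLevel-balance (+ 0) P
    ... | eq rewrite eastCount | northCount | ℕ.*-comm n (k ℕ.* n) = eq

  annotate-nonneg : ∀ {e} j ℓ P → e ∈ annotate k n j ℓ P →
    All (+ 0 ≤_) (pointLevels k n ℓ P) → + 0 ≤ level e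
  annotate-nonneg j ℓ (s ∷ P) (here refl) (0≤ℓ ∷ _) = 0≤ℓ
  annotate-nonneg j ℓ (s ∷ P) (there e∈) (_ ∷ 0≤P) = annotate-nonneg (suc j) (ℓ + δ k n s) P e∈ 0≤P

  -- Levels change by kn or -n, so every level from t + cn down to below t
  -- passes through t itself.
  annotate-reaches-level : ∀ j t c ℓ Q → ℓ ≡ t + + (c ℕ.* n) → finalLevel ℓ Q < t →
    ∃ λ f → f ∈ annotate k n j ℓ Q × level f ≡ t × j ℕ.≤ pos f
  annotate-reaches-level j t c ℓ [] refl final<t =
    ⊥-elim (ℤ.<-irrefl refl (ℤ.<-≤-trans final<t (ℤ.i≤i+j t (+ (c ℕ.* n)))))
  annotate-reaches-level j t ℕ.zero ℓ (s ∷ Q) ℓ≡t final<t =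
    entry s ℓ j , here refl , trans ℓ≡t (ℤ.+-identityʳ t) , ℕ.≤-refl
  annotate-reaches-level j t (suc c) ℓ (s ∷ Q) refl final<t
    with annotate-reaches-level (suc j) t (c′ s) _ Q (next-level s) final<t
    where
    c′ : Step → ℕ
    c′ S = suc c ℕ.+ k
    c′ W = c
    next-level : ∀ s → t + + (suc c ℕ.* n) + δ k n s ≡ t + + (c′ s ℕ.* n)
    next-level S = begin
      t + + (suc c ℕ.* n) + + (k ℕ.* n)     ≡⟨ ℤ.+-assoc t _ _ ⟩
      t + + (suc c ℕ.* n ℕ.+ k ℕ.* n)       ≡⟨ cong (λ m → t + + m) (ℕ.*-distribʳ-+ n (suc c) k) ⟨
      t + + ((suc c ℕ.+ k) ℕ.* n) ∎
      where open ≡-Reasoning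
    next-level W = cancel t (+ n) (+ (c ℕ.* n))
      where
      cancel : ∀ x y z → x + (y + z) - y ≡ x + z
      cancel = solve-∀
  ... | f , f∈ , level≡t , j<pos = f , there f∈ , level≡t , ℕ.<⇒≤ j<pos

  later-step-at-level : ∀ j ℓ P t q → entry S t q ∈ annotate k n j ℓ P → finalLevel ℓ P < t →
    ∃ λ f → f ∈ annotate k n j ℓ P × level f ≡ t × q ℕ.< pos f
  later-step-at-level j ℓ (S ∷ P) _ _ (here refl) final<t
    with annotate-reaches-level (suc j) ℓ k (ℓ + + (k ℕ.* n)) P refl final<t
  ... | f , f∈ , level≡t , j<pos = f , there f∈ , level≡t , j<pos
  later-step-at-level j ℓ (s ∷ P) t q (there e∈) final<t
    with later-step-at-level (suc j) (ℓ + δ k n s) P t q e∈ final<t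
  ... | f , f∈ , level≡t , q<pos = f , there f∈ , level≡t , q<pos

  sweptEntries : List Step → List Entry
  sweptEntries P = sortSweep (annotate k n 0 (+ 0) P)

  sweptEntries-S-level : ∀ P → IsDyck k n P → ∀ j {a t q} →
    sweptEntries P ‼ j ≡ just a → sweptEntries P ‼ suc j ≡ just (entry S t q) →
    t ≡ level a
  sweptEntries-S-level P dyck j {a} {t} {q} xs[j]≡a xs[j+1]≡e with t ≟ level a
  ... | yes t≡a = t≡a
  ... | no t≢a = ⊥-elim (refute (later-step-at-level 0 (+ 0) P t q (into-A (suc j) xs[j+1]≡e) final<t))
    where
    A xs : List Entry
    A = annotate k n 0 (+ 0) P
    xs = sweptEntries P
    e : Entry
    e = entry S t q
    sorted : Sorted xs
    sorted = sortSweep-sorted A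
    into-A : ∀ i {x} → xs ‼ i ≡ just x → x ∈ A
    into-A i xs[i]≡x = ∈-resp-↭ (sortSweep-↭ A) (‼-∈ xs i xs[i]≡x)
    a<t : level a < t
    a<t = ℤ.≤∧≢⇒< (ℤ.≮⇒≥ λ t<a → sorted-‼-suc xs j sorted xs[j]≡a xs[j+1]≡e (<-level⇒before e a t<a))
                   (λ a≡t → t≢a (sym a≡t))
    final<t : finalLevel (+ 0) P < t
    final<t rewrite finalLevel-dyck P dyck =
      ℤ.≤-<-trans (annotate-nonneg 0 (+ 0) P (into-A j xs[j]≡a) (IsDyck.aboveDiag dyck)) a<t
    refute : (∃ λ f → f ∈ A × level f ≡ t × q ℕ.< pos f) → ⊥
    refute (f , f∈A , f-level , q<pos) =
      sorted-before-successor xs j sorted xs[j]≡a xs[j+1]≡e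
        (∈-resp-↭ (↭-sym (sortSweep-↭ A)) f∈A)
        (≡-level⇒before f e f-level q<pos)
        (<-level⇒before a f (subst (level a <_) (sym f-level) a<t))

  sweep-S-level : ∀ P → IsDyck k n P → ∀ j {x u t} →
    sweep k n P ‼ j ≡ just (x , u) → sweep k n P ‼ suc j ≡ just (S , t) → t ≡ u
  sweep-S-level P dyck j xs[j] xs[j+1]
    with ‼-map _ (sweptEntries P) j xs[j] | ‼-map _ (sweptEntries P) (suc j) xs[j+1]
  ... | a , xs[j]≡a , refl | entry _ _ _ , xs[j+1]≡e , refl =
    sweptEntries-S-level P dyck j xs[j]≡a xs[j+1]≡e

open Path using (sweep-S-level)

theorem2p1 : (k n : ℕ) → NonZero k → NonZero n → (P : List Step) → IsDyck k n P →
    (i : ℕ) (m : ℤ) →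
    sweep k n P ‼ i ≡ just (W , m * + n) →
    ((t : ℤ) → sweep k n P ‼ suc i ≡ just (S , t) → t ≡ m * + n) ×
    ((t t′ : ℤ) → sweep k n P ‼ suc i ≡ just (S , t) →
      sweep k n P ‼ suc (suc i) ≡ just (S , t′) → t′ ≡ m * + n)
theorem2p1 k n _ _ P dyck i m σᵢ = first , second
  where
  first : (t : ℤ) → sweep k n P ‼ suc i ≡ just (S , t) → t ≡ m * + n
  first t σᵢ₊₁ = sweep-S-level k n P dyck i σᵢ σᵢ₊₁
  second : (t t′ : ℤ) → sweep k n P ‼ suc i ≡ just (S , t) →
    sweep k n P ‼ suc (suc i) ≡ just (S , t′) → t′ ≡ m * + n
  second t t′ σᵢ₊₁ σᵢ₊₂ = trans (sweep-S-level k n P dyck (suc i) σᵢ₊₁ σᵢ₊₂) (first t σᵢ₊₁)
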